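{- Let $\mathcal{T}$ be a test cover of $[n]$ and $k$ a positive integer. If the algorithm Greedy-mini-test applied to $\mathcal{T}$ and $k$ produces a collection $\mathcal{F}$ with $|\mathcal{F}|\ge 2k-2$, then $\mathcal{F}$ is a $k$-mini test cover.
   Context: $[n]=\{1,\ldots,n\}$ is the set of items; tests are subsets of $[n]$ and $\mathcal{T}$ is a collection of distinct tests. A test $T$ separates distinct items $i,j$ if $|\{i,j\}\cap T|=1$; a collection of tests is a test cover of $[n]$ if every pair of distinct items is separated by one of its tests. The classes induced by a collection $\mathcal{F}$ of tests are the equivalence classes of the relation "$i,j$ are not separated by any test of $\mathcal{F}$". A subcollection $\mathcal{F}\subseteq\mathcal{T}$ is a $k$-mini test cover if $|\mathcal{F}|\le 2k$ and $\mathcal{F}$ induces at least $|\mathcal{F}|+k$ classes. Algorithm Greedy-mini-test($\mathcal{T}$, $k$): start with $\mathcal{F}=\emptyset$; repeatedly, as long as $|\mathcal{F}|<2k-2$ and one of the following moves is possible, perform one: (a) add two tests of $\mathcal{T}\setminus\mathcal{F}$ to $\mathcal{F}$ if this increases the number of classes induced by $\mathcal{F}$ by at least $3$; (b) add one test of $\mathcal{T}\setminus\mathcal{F}$ to $\mathcal{F}$ if this increases the number of classes induced by $\mathcal{F}$ by at least $2$. Stop when $|\mathcal{F}|\ge 2k-2$ or no move is possible, and output $\mathcal{F}$. -}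

module Defs where

open import Data.Bool using (Bool; true; false; not; _xor_; _∧_)
import Data.Bool.Properties as BoolP
open import Data.Nat using (ℕ; _+_; _*_; _∸_; _≤_; _<_; _≥_)
open import Data.Fin using (Fin)
open import Data.Fin.Subset using (Subset)
open import Data.Vec using (lookup; tabulate)
import Data.Vec.Properties as VecP
open import Data.List using (List; []; _∷_; length; map; allFin; deduplicate)
open import Data.List.Membership.Propositional using (_∈_; _∉_)
open import Data.List.Relation.Unary.All using (All)
open import Data.List.Relation.Unary.Any using (Any)
open import Data.Product using (_×_)
open import Relation.Binary.PropositionalEquality using (_≡_; _≢_)

Test : ℕ → Set
Test n = Subset n

separates : ∀ {n} → Test n → Fin n → Fin n → Bool
separates T i j = lookup T i xor lookup T j

allB : ∀ {A : Set} → (A → Bool) → List A → Bool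
allB p [] = true
allB p (x ∷ xs) = p x ∧ allB p xs

sameClass : ∀ {n} → List (Test n) → Fin n → Fin n → Bool
sameClass F i j = allB (λ T → not (separates T i j)) F

classOf : ∀ {n} → List (Test n) → Fin n → Subset n
classOf F i = tabulate (sameClass F i)

numClasses : ∀ {n} → List (Test n) → ℕ
numClasses {n} F =
  length (deduplicate (VecP.≡-dec BoolP._≟_) (map (classOf F) (allFin n)))

IsTestCover : ∀ {n} → List (Test n) → Set
IsTestCover {n} 𝒯 = ∀ (i j : Fin n) → i ≢ j → Any (λ T → separates T i j ≡ true) 𝒯

IsMiniTestCover : ∀ {n} → List (Test n) → ℕ → List (Test n) → Set
IsMiniTestCover 𝒯 k F =
  All (_∈ 𝒯) F × length F ≤ 2 * k × numClasses F ≥ length F + k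

-- States reachable by a (nondeterministic) run of Greedy-mini-test(𝒯, k).
data GreedyRun {n} (𝒯 : List (Test n)) (k : ℕ) : List (Test n) → Set where
  start : GreedyRun 𝒯 k []
  moveA : ∀ {F} (t₁ t₂ : Test n) → GreedyRun 𝒯 k F → length F < 2 * k ∸ 2 →
          t₁ ∈ 𝒯 → t₂ ∈ 𝒯 → t₁ ∉ F → t₂ ∉ F → t₁ ≢ t₂ →
          numClasses (t₁ ∷ t₂ ∷ F) ≥ numClasses F + 3 →
          GreedyRun 𝒯 k (t₁ ∷ t₂ ∷ F)
  moveB : ∀ {F} (t : Test n) → GreedyRun 𝒯 k F → length F < 2 * k ∸ 2 →
          t ∈ 𝒯 → t ∉ F →
          numClasses (t ∷ F) ≥ numClasses F + 2 →
          GreedyRun 𝒯 k (t ∷ F)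

-- Each greedy move adds at least 3 classes per 2 tests, and the empty collection
-- already induces one class, so 2 + 3|F| ≤ 2·(number of classes) holds along every
-- run. Once |F| ≥ 2k − 2 this gives at least |F| + k classes, while the guard
-- |F| < 2k − 2 before the last move (of at most two tests) gives |F| ≤ 2k.
module Submission where

open import Defs
open import Data.Nat using (ℕ; suc; _+_; _*_; _∸_; _≥_; _≤_; s≤s; z≤n)
open import Data.Nat.Properties
  using (≤-refl; +-mono-≤; +-monoʳ-≤; *-monoʳ-≤; *-cancelˡ-≤; *-distribˡ-∸; *-suc; m≤n⇒m≤1+n; n≤1+n;
         module ≤-Reasoning)
open import Data.Nat.Tactic.RingSolver using (solve-∀)
open import Data.List using (List; []; _∷_; length)
open import Data.List.Relation.Unary.All using (All; []; _∷_)
open import Data.List.Relation.Unary.Unique.Propositional using (Unique)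
open import Data.List.Membership.Propositional using (_∈_)
open import Data.Product using (_,_)
open import Relation.Binary.PropositionalEquality using (_≡_; sym; subst)

numClasses-[]-positive : ∀ {n} → 1 ≤ n → 1 ≤ numClasses {n} []
numClasses-[]-positive (s≤s z≤n) = s≤s z≤n

invariant-step : ∀ {a d L c c′} → 3 * a ≤ 2 * d → 2 + 3 * L ≤ 2 * c → c + d ≤ c′ →
                 2 + 3 * (a + L) ≤ 2 * c′
invariant-step {a} {d} {L} {c} {c′} gain inv grow = begin
  2 + 3 * (a + L)     ≡⟨ regroup a L ⟩
  3 * a + (2 + 3 * L) ≤⟨ +-mono-≤ gain inv ⟩
  2 * d + 2 * c       ≡⟨ factor d c ⟩
  2 * (c + d)         ≤⟨ *-monoʳ-≤ 2 grow ⟩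
  2 * c′              ∎
  where
  open ≤-Reasoning
  regroup : ∀ a L → 2 + 3 * (a + L) ≡ 3 * a + (2 + 3 * L)
  regroup = solve-∀
  factor : ∀ d c → 2 * d + 2 * c ≡ 2 * (c + d)
  factor = solve-∀

classes-≥-length+k : ∀ {j L c} → 2 * j ≤ L → 2 + 3 * L ≤ 2 * c → L + suc j ≤ c
classes-≥-length+k {j} {L} {c} long inv = *-cancelˡ-≤ 2 (begin
  2 * (L + suc j)     ≡⟨ expand L j ⟩
  2 + (2 * L + 2 * j) ≤⟨ +-monoʳ-≤ (2 + 2 * L) long ⟩
  2 + (2 * L + L)     ≡⟨ collect L ⟩
  2 + 3 * L           ≤⟨ inv ⟩
  2 * c               ∎)
  where
  open ≤-Reasoning
  expand : ∀ L j → 2 * (L + suc j) ≡ 2 + (2 * L + 2 * j)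
  expand = solve-∀
  collect : ∀ L → 2 + (2 * L + L) ≡ 2 + 3 * L
  collect = solve-∀

module _ {n : ℕ} {𝒯 : List (Test n)} {k : ℕ} where

  greedy-⊆ : ∀ {F} → GreedyRun 𝒯 k F → All (_∈ 𝒯) F
  greedy-⊆ start = []
  greedy-⊆ (moveA _ _ run _ t₁∈𝒯 t₂∈𝒯 _ _ _ _) = t₁∈𝒯 ∷ t₂∈𝒯 ∷ greedy-⊆ run
  greedy-⊆ (moveB _ run _ t∈𝒯 _ _) = t∈𝒯 ∷ greedy-⊆ run

  greedy-length-≤ : ∀ {F} → GreedyRun 𝒯 k F → length F ≤ suc (2 * k ∸ 2)
  greedy-length-≤ start = z≤n
  greedy-length-≤ (moveA _ _ _ guard _ _ _ _ _ _) = s≤s guard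
  greedy-length-≤ (moveB _ _ guard _ _ _) = m≤n⇒m≤1+n guard

  greedy-classes : ∀ {F} → 1 ≤ n → GreedyRun 𝒯 k F → 2 + 3 * length F ≤ 2 * numClasses F
  greedy-classes n≥1 start = *-monoʳ-≤ 2 (numClasses-[]-positive n≥1)
  greedy-classes n≥1 (moveA _ _ run _ _ _ _ _ _ gain) =
    invariant-step {a = 2} {d = 3} ≤-refl (greedy-classes n≥1 run) gain
  greedy-classes n≥1 (moveB _ run _ _ _ gain) =
    invariant-step {a = 1} {d = 2} (n≤1+n 3) (greedy-classes n≥1 run) gain

lemma2 : (n : ℕ) → 1 ≤ n → (𝒯 : List (Test n)) → Unique 𝒯 → IsTestCover 𝒯 →
         (k : ℕ) → 1 ≤ k → (F : List (Test n)) → GreedyRun 𝒯 k F →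
         length F ≥ 2 * k ∸ 2 → IsMiniTestCover 𝒯 k F
lemma2 n n≥1 𝒯 _ _ (suc j) _ F run long =
  greedy-⊆ run , length-≤ , classes-≥-length+k long′ (greedy-classes n≥1 run)
  where
  2k∸2≡2j : 2 * suc j ∸ 2 ≡ 2 * j
  2k∸2≡2j = sym (*-distribˡ-∸ 2 (suc j) 1)
  long′ : 2 * j ≤ length F
  long′ = subst (_≤ length F) 2k∸2≡2j long
  length-≤ : length F ≤ 2 * suc j
  length-≤ = begin
    length F       ≤⟨ subst (λ m → length F ≤ suc m) 2k∸2≡2j (greedy-length-≤ run) ⟩
    suc (2 * j)    ≤⟨ n≤1+n _ ⟩
    2 + 2 * j      ≡⟨ sym (*-suc 2 j) ⟩
    2 * suc j      ∎
    where open ≤-Reasoning
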